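{- Let $G$ be a finite simple graph of order $n$ having no connected component of order less than $3$, and let $\mathcal{G}$ be an arbitrary Abelian group of order at least $2n$. Then there exists a labeling $f\colon E(G)\to\mathcal{G}$ such that $f(e)\neq 0$ for every edge $e$, $w_f(v)\neq 0$ for every vertex $v$, and the weights $w_f(v)$, $v\in V(G)$, are pairwise distinct.
   Context: For an Abelian group $\mathcal{G}$ (written additively, identity $0$) and an edge labeling $f\colon E(G)\to\mathcal{G}$, the weight (weighted degree) of a vertex $v$ is $w_f(v)=\sum_{u\in N(v)} f(uv)$, computed in $\mathcal{G}$, where $N(v)$ is the set of neighbours of $v$. -}

module Defs where

open import Level using (Level; _⊔_)
open import Data.Nat using (ℕ; _≤_; _*_)
open import Data.Fin using (Fin)
open import Data.Bool using (Bool; true; false; if_then_else_)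
open import Data.List using (List; foldr; allFin)
open import Data.Product using (Σ; ∃; _×_; _,_)
open import Relation.Binary.PropositionalEquality as ≡ using (_≡_; _≢_)
open import Relation.Nullary using (¬_)
open import Algebra.Bundles using (AbelianGroup)
open import Function.Bundles using (Bijection)

record SimpleGraph (n : ℕ) : Set where
  field
    adj     : Fin n → Fin n → Bool
    adj-sym : ∀ u v → adj u v ≡ adj v u
    irrefl  : ∀ v → adj v v ≡ false
open SimpleGraph public

data Reach {n : ℕ} (G : SimpleGraph n) : Fin n → Fin n → Set where
  here : ∀ {v} → Reach G v v
  step : ∀ {u w x} → adj G u w ≡ true → Reach G w x → Reach G u x

-- Every connected component of G has at least 3 vertices:
-- the component of each vertex v contains two further distinct vertices.
NoSmallComponents : {n : ℕ} → SimpleGraph n → Set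
NoSmallComponents {n} G =
  ∀ (v : Fin n) → Σ (Fin n) λ u → Σ (Fin n) λ w →
    (v ≢ u) × (v ≢ w) × (u ≢ w) × Reach G v u × Reach G v w

HasOrder : ∀ {c ℓ} → AbelianGroup c ℓ → ℕ → Set (c ⊔ ℓ)
HasOrder A m = Bijection (≡.setoid (Fin m)) (AbelianGroup.setoid A)

module _ {c ℓ} (A : AbelianGroup c ℓ) where
  open AbelianGroup A

  -- An edge labeling f : E(G) → A is represented by a symmetric function
  -- f : Fin n → Fin n → Carrier whose values on non-edges are irrelevant.
  IsEdgeLabeling : {n : ℕ} → SimpleGraph n → (Fin n → Fin n → Carrier) → Set ℓ
  IsEdgeLabeling {n} G f = ∀ u v → adj G u v ≡ true → f u v ≈ f v u

  weight : {n : ℕ} → SimpleGraph n → (Fin n → Fin n → Carrier) → Fin n → Carrier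
  weight {n} G f v =
    foldr (λ u acc → (if adj G v u then f v u else ε) ∙ acc) ε (allFin n)

-- Induction on the number of edges proves more, for every finite simple graph: there is a
-- labeling with nonzero edge labels in which non-isolated vertices have nonzero weights,
-- pairwise distinct unless the two vertices form a K₂ component.  Remove an edge ab and label
-- the rest by induction; labeling ab by x adds x to the weights of a and b and changes nothing
-- else.  The requirements x ≠ 0, w(a) + x ≠ 0, w(b) + x ≠ 0 and w(a) + x, w(b) + x ∉ {w(z) ∣
-- z ≠ a, b} exclude at most 2n − 1 values, so a group of order at least 2n leaves a choice.
-- The endpoints stay apart because w(a) ≠ w(b) in G − ab, unless both are isolated there,
-- i.e. unless ab is a K₂ component of G.  Without small components there are neither
-- isolated vertices nor K₂ components.

module Submission where

open import Defs
open import Data.Nat using (ℕ; zero; suc; _≤_; _<_; _*_; _+_; z≤n)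
import Data.Nat.Properties as ℕ
open import Data.Nat.Induction using (<-wellFounded)
open import Data.Nat.ListAction using (sum)
open import Induction.WellFounded using (Acc; acc)
open import Data.Fin using (Fin; zero; suc; punchIn; punchOut; _↑ˡ_; _↑ʳ_)
import Data.Fin.Properties as Fin
open import Data.Bool using (Bool; true; false; if_then_else_)
import Data.Bool.Properties as Bool
open import Data.List using (tabulate)
import Data.List as List
open import Data.Vec.Functional using (Vector; removeAt; updateAt; _++_)
open import Data.Vec.Functional.Properties
  using (updateAt-updates; updateAt-minimal; lookup-++ˡ; lookup-++ʳ)
open import Data.Product using (Σ; ∃; _×_; _,_; proj₁; proj₂)
open import Data.Sum as Sum using (_⊎_; inj₁; inj₂)
open import Function using (_∘_; id)
open import Function.Definitions using (Injective)
open import Relation.Binary.PropositionalEquality as ≡ using (_≡_; _≢_; refl)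
open import Relation.Nullary using (¬_; yes; no; contradiction; ¬?)
open import Relation.Nullary.Decidable using (Dec; _×-dec_; _⊎-dec_; decidable-stable)
open import Algebra.Bundles using (AbelianGroup)
open import Function.Bundles using (Bijection)

∃∉image : ∀ {k m} → k < m → (h : Fin k → Fin m) → ∃ λ j → ∀ i → h i ≢ j
∃∉image {k} {m} k<m h with Fin.any? (λ j → Fin.all? (λ i → ¬? (h i Fin.≟ j)))
... | yes missed = missed
... | no ¬missed = contradiction (Fin.injective⇒≤ section-injective) (ℕ.<⇒≱ k<m)
  where
  preimage : ∀ j → ∃ λ i → h i ≡ j
  preimage j with Fin.¬∀⟶∃¬ k _ (λ i → ¬? (h i Fin.≟ j)) (λ h≢j → ¬missed (j , h≢j))
  ... | i , ¬h≢j = i , decidable-stable (h i Fin.≟ j) ¬h≢j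

  section-injective : Injective _≡_ _≡_ (proj₁ ∘ preimage)
  section-injective {j} {j′} eq =
    ≡.trans (≡.sym (proj₂ (preimage j))) (≡.trans (≡.cong h eq) (proj₂ (preimage j′)))

sum-tabulate-mono-≤ : ∀ {k} {s t : Fin k → ℕ} → (∀ i → s i ≤ t i) →
  sum (tabulate s) ≤ sum (tabulate t)
sum-tabulate-mono-≤ {zero}  s≤t = z≤n
sum-tabulate-mono-≤ {suc k} s≤t = ℕ.+-mono-≤ (s≤t zero) (sum-tabulate-mono-≤ (s≤t ∘ suc))

sum-tabulate-mono-< : ∀ {k} {s t : Fin k → ℕ} → (∀ i → s i ≤ t i) → (j : Fin k) → s j < t j →
  sum (tabulate s) < sum (tabulate t)
sum-tabulate-mono-< s≤t zero    sj<tj = ℕ.+-mono-<-≤ sj<tj (sum-tabulate-mono-≤ (s≤t ∘ suc))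
sum-tabulate-mono-< s≤t (suc j) sj<tj =
  ℕ.+-mono-≤-< (s≤t zero) (sum-tabulate-mono-< (s≤t ∘ suc) j sj<tj)

1+n+n<2*[1+n] : ∀ n → suc n + n < 2 * suc n
1+n+n<2*[1+n] n = begin-strict
  suc n + n      <⟨ ℕ.+-monoʳ-< (suc n) (ℕ.n<1+n n) ⟩
  suc n + suc n  ≡⟨ ≡.cong (suc n +_) (ℕ.+-identityʳ (suc n)) ⟨
  2 * suc n      ∎
  where open ℕ.≤-Reasoning

module _ {n : ℕ} where

  SamePair : (a b u v : Fin n) → Set
  SamePair a b u v = (u ≡ a × v ≡ b) ⊎ (u ≡ b × v ≡ a)

  samePair? : ∀ a b u v → Dec (SamePair a b u v)
  samePair? a b u v = ((u Fin.≟ a) ×-dec (v Fin.≟ b)) ⊎-dec ((u Fin.≟ b) ×-dec (v Fin.≟ a))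

  samePair-swap : ∀ {a b u v} → SamePair a b u v → SamePair a b v u
  samePair-swap (inj₁ (u≡a , v≡b)) = inj₂ (v≡b , u≡a)
  samePair-swap (inj₂ (u≡b , v≡a)) = inj₁ (v≡a , u≡b)

  samePair-unique : ∀ {a b s t t′} → a ≢ b → SamePair a b s t → SamePair a b s t′ → t ≡ t′
  samePair-unique a≢b (inj₁ (_ , t≡b))   (inj₁ (_ , t′≡b)) = ≡.trans t≡b (≡.sym t′≡b)
  samePair-unique a≢b (inj₁ (s≡a , _))   (inj₂ (s≡b , _))  = contradiction (≡.trans (≡.sym s≡a) s≡b) a≢b
  samePair-unique a≢b (inj₂ (s≡b , _))   (inj₁ (s≡a , _))  = contradiction (≡.trans (≡.sym s≡a) s≡b) a≢b
  samePair-unique a≢b (inj₂ (_ , t≡a))   (inj₂ (_ , t′≡a)) = ≡.trans t≡a (≡.sym t′≡a)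

  overridePair : ∀ {x} {X : Set x} (a b : Fin n) → X → (Fin n → Fin n → X) → Fin n → Fin n → X
  overridePair a b x g u v with samePair? a b u v
  ... | yes _ = x
  ... | no  _ = g u v

  module _ {x} {X : Set x} {a b : Fin n} {y : X} {g : Fin n → Fin n → X} {u v : Fin n} where

    overridePair-same : SamePair a b u v → overridePair a b y g u v ≡ y
    overridePair-same p with samePair? a b u v
    ... | yes _ = refl
    ... | no ¬p = contradiction p ¬p

    overridePair-other : ¬ SamePair a b u v → overridePair a b y g u v ≡ g u v
    overridePair-other ¬p with samePair? a b u v
    ... | yes p = contradiction p ¬p
    ... | no  _ = refl

  data Position (a b : Fin n) : Fin n → Set where
    at-a : Position a b a
    at-b : Position a b b
    away : ∀ {z} → z ≢ a → z ≢ b → Position a b z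

  position : ∀ a b z → Position a b z
  position a b z with z Fin.≟ a | z Fin.≟ b
  ... | yes refl | _        = at-a
  ... | no _     | yes refl = at-b
  ... | no z≢a   | no z≢b   = away z≢a z≢b

  away⇒¬samePair : ∀ {a b z} w → z ≢ a → z ≢ b → ¬ SamePair a b z w
  away⇒¬samePair _ z≢a z≢b = Sum.[ z≢a ∘ proj₁ , z≢b ∘ proj₁ ]

  HasNeighbour : SimpleGraph n → Fin n → Set
  HasNeighbour G v = ∃ λ u → adj G v u ≡ true

  hasNeighbour? : ∀ (G : SimpleGraph n) v → Dec (HasNeighbour G v)
  hasNeighbour? G v = Fin.any? (λ u → adj G v u Bool.≟ true)

  someEdge? : ∀ (G : SimpleGraph n) → Dec (∃ (HasNeighbour G))
  someEdge? G = Fin.any? (hasNeighbour? G)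

  adj⇒≢ : ∀ (G : SimpleGraph n) {u v} → adj G u v ≡ true → u ≢ v
  adj⇒≢ G {u} uv refl = Bool.not-¬ (irrefl G u) uv

  samePair-adj : ∀ (G : SimpleGraph n) {a b u v} →
    adj G a b ≡ true → SamePair a b u v → adj G u v ≡ true
  samePair-adj G ab (inj₁ (refl , refl)) = ab
  samePair-adj G ab (inj₂ (refl , refl)) = ≡.trans (adj-sym G _ _) ab

  IsK₂Component : SimpleGraph n → Fin n → Fin n → Set
  IsK₂Component G u v =
    adj G u v ≡ true × (∀ w → adj G u w ≡ true → w ≡ v) × (∀ w → adj G v w ≡ true → w ≡ u)

  K₂-sym : ∀ {G : SimpleGraph n} {u v} → IsK₂Component G u v → IsK₂Component G v u
  K₂-sym {G} (uv , only-v , only-u) = ≡.trans (adj-sym G _ _) uv , only-u , only-v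

  K₂-closed : ∀ {G : SimpleGraph n} {u v z} → IsK₂Component G u v → Reach G u z → z ≡ u ⊎ z ≡ v
  K₂-closed k₂ here = inj₁ refl
  K₂-closed {G} k₂@(_ , only-v , _) (step uw w⇝z) with only-v _ uw
  ... | refl = Sum.swap (K₂-closed (K₂-sym {G} k₂) w⇝z)

  K₂-reach-other : ∀ {G : SimpleGraph n} {u v z} →
    IsK₂Component G u v → u ≢ z → Reach G u z → z ≡ v
  K₂-reach-other k₂ u≢z u⇝z with K₂-closed k₂ u⇝z
  ... | inj₁ z≡u = contradiction (≡.sym z≡u) u≢z
  ... | inj₂ z≡v = z≡v

  noSmallComponents⇒¬K₂ : ∀ {G : SimpleGraph n} → NoSmallComponents G →
    ∀ u v → ¬ IsK₂Component G u v
  noSmallComponents⇒¬K₂ nsc u v k₂ with nsc u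
  ... | p , q , u≢p , u≢q , p≢q , u⇝p , u⇝q =
    p≢q (≡.trans (K₂-reach-other k₂ u≢p u⇝p) (≡.sym (K₂-reach-other k₂ u≢q u⇝q)))

  noSmallComponents⇒HasNeighbour : ∀ {G : SimpleGraph n} → NoSmallComponents G →
    ∀ v → HasNeighbour G v
  noSmallComponents⇒HasNeighbour nsc v with nsc v
  ... | p , _ , v≢p , _ , _ , v⇝p , _ = first-step v≢p v⇝p
    where
    first-step : ∀ {G : SimpleGraph n} {u z} → u ≢ z → Reach G u z → HasNeighbour G u
    first-step u≢z here       = contradiction refl u≢z
    first-step _   (step uw _) = _ , uw

  removeEdge : SimpleGraph n → Fin n → Fin n → SimpleGraph n
  removeEdge G a b = record
    { adj     = overridePair a b false (adj G)
    ; adj-sym = symmetric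
    ; irrefl  = λ v → no-loop v (samePair? a b v v)
    }
    where
    symmetric : ∀ u v → overridePair a b false (adj G) u v ≡ overridePair a b false (adj G) v u
    symmetric u v with samePair? a b u v
    ... | yes p = ≡.sym (overridePair-same (samePair-swap p))
    ... | no ¬p = ≡.trans (adj-sym G u v) (≡.sym (overridePair-other (¬p ∘ samePair-swap)))

    no-loop : ∀ v → Dec (SamePair a b v v) → overridePair a b false (adj G) v v ≡ false
    no-loop v (yes p) = overridePair-same p
    no-loop v (no ¬p) = ≡.trans (overridePair-other ¬p) (irrefl G v)

  module RemoveEdge (G : SimpleGraph n) (a b : Fin n) where

    removeEdge-removes : adj (removeEdge G a b) a b ≡ false
    removeEdge-removes = overridePair-same {a = a} {b = b} {g = adj G} (inj₁ (refl , refl))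

    adj-removeEdge⇒adj : ∀ {u v} → adj (removeEdge G a b) u v ≡ true → adj G u v ≡ true
    adj-removeEdge⇒adj {u} {v} e = by-cases (samePair? a b u v)
      where
      by-cases : Dec (SamePair a b u v) → adj G u v ≡ true
      by-cases (yes p) = contradiction (≡.trans (≡.sym (overridePair-same p)) e) λ ()
      by-cases (no ¬p) = ≡.trans (≡.sym (overridePair-other ¬p)) e

    adj⇒adj-removeEdge : ∀ {u v} → ¬ SamePair a b u v →
      adj G u v ≡ true → adj (removeEdge G a b) u v ≡ true
    adj⇒adj-removeEdge ¬p e = ≡.trans (overridePair-other ¬p) e

    HasNeighbour-removeEdge : ∀ {z} → z ≢ a → z ≢ b →
      HasNeighbour G z → HasNeighbour (removeEdge G a b) z
    HasNeighbour-removeEdge z≢a z≢b (w , zw) = w , adj⇒adj-removeEdge (away⇒¬samePair w z≢a z≢b) zw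

    K₂-removeEdge : ∀ {u v} → u ≢ a → u ≢ b → v ≢ a → v ≢ b →
      IsK₂Component (removeEdge G a b) u v → IsK₂Component G u v
    K₂-removeEdge u≢a u≢b v≢a v≢b (uv , only-v , only-u) =
      adj-removeEdge⇒adj uv ,
      (λ w uw → only-v w (adj⇒adj-removeEdge (away⇒¬samePair w u≢a u≢b) uw)) ,
      (λ w vw → only-u w (adj⇒adj-removeEdge (away⇒¬samePair w v≢a v≢b) vw))

  edgeCount : SimpleGraph n → ℕ
  edgeCount G = sum (tabulate λ u → sum (tabulate λ v → if adj G u v then 1 else 0))

  edgeCount-removeEdge : ∀ (G : SimpleGraph n) {a b} →
    adj G a b ≡ true → edgeCount (removeEdge G a b) < edgeCount G
  edgeCount-removeEdge G {a} {b} ab =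
    sum-tabulate-mono-< (λ u → sum-tabulate-mono-≤ (entry-≤ u))
      a (sum-tabulate-mono-< (entry-≤ a) b removed)
    where
    open RemoveEdge G a b

    indicator-mono : ∀ {x y : Bool} → (x ≡ true → y ≡ true) →
      (if x then 1 else 0) ≤ (if y then 1 else 0)
    indicator-mono {false} _   = z≤n
    indicator-mono {true}  x⇒y rewrite x⇒y refl = ℕ.≤-refl

    entry-≤ : ∀ u v →
      (if adj (removeEdge G a b) u v then 1 else 0) ≤ (if adj G u v then 1 else 0)
    entry-≤ u v = indicator-mono adj-removeEdge⇒adj

    removed : (if adj (removeEdge G a b) a b then 1 else 0) < (if adj G a b then 1 else 0)
    removed = ≡.subst₂ (λ e e′ → (if e then 1 else 0) < (if e′ then 1 else 0))
      (≡.sym removeEdge-removes) (≡.sym ab) (ℕ.n<1+n 0)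

module _ {c ℓ} (A : AbelianGroup c ℓ) where

  open AbelianGroup A hiding (refl)
  open import Algebra.Properties.AbelianGroup A using (y≈x\\z; ∙-cancelʳ)
  open import Algebra.Properties.CommutativeSemigroup commutativeSemigroup using (xy∙z≈xz∙y)
  open import Algebra.Properties.CommutativeMonoid.Sum commutativeMonoid
    using (sum-remove; sum-cong-≋; sum-cong-≗; sum-replicate-zero) renaming (sum to ∑)
  open import Relation.Binary.Reasoning.Setoid setoid

  module _ {m} (order : HasOrder A m) where

    open Bijection order using (to; injective; surjective)

    ∃≉image : ∀ {k} → k < m → (g : Fin k → Carrier) → ∃ λ x → ∀ i → ¬ x ≈ g i
    ∃≉image k<m g with ∃∉image k<m (proj₁ ∘ surjective ∘ g)
    ... | j , missed = to j , λ i to-j≈g-i →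
      missed i (≡.sym (injective (trans to-j≈g-i (sym (proj₂ (surjective (g i)) refl)))))

    ∃-avoiding-translates : ∀ {n} → 2 * n ≤ m → (b : Fin n) (s t : Carrier) (v : Fin n → Carrier) →
      ∃ λ x → (∀ z → ¬ s ∙ x ≈ v z) × (∀ z → z ≢ b → ¬ t ∙ x ≈ v z)
    ∃-avoiding-translates {suc n} 2n≤m b s t v = x , avoid-s , avoid-t
      where
      s-shifted : Vector Carrier (suc n)
      s-shifted z = s ⁻¹ ∙ v z

      t-shifted : Vector Carrier n
      t-shifted j = t ⁻¹ ∙ v (punchIn b j)

      forbidden : Vector Carrier (suc n + n)
      forbidden = s-shifted ++ t-shifted

      chosen : ∃ λ x → ∀ i → ¬ x ≈ forbidden i
      chosen = ∃≉image (ℕ.<-≤-trans (1+n+n<2*[1+n] n) 2n≤m) forbidden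

      x : Carrier
      x = proj₁ chosen

      avoid-s : ∀ z → ¬ s ∙ x ≈ v z
      avoid-s z sx≈vz = proj₂ chosen (z ↑ˡ n) (begin
        x                 ≈⟨ y≈x\\z s x (v z) sx≈vz ⟩
        s ⁻¹ ∙ v z        ≡⟨ lookup-++ˡ s-shifted t-shifted z ⟨
        forbidden (z ↑ˡ n) ∎)

      avoid-t : ∀ z → z ≢ b → ¬ t ∙ x ≈ v z
      avoid-t z z≢b tx≈vz = proj₂ chosen (suc n ↑ʳ j) (begin
        x                       ≈⟨ y≈x\\z t x (v z) tx≈vz ⟩
        t ⁻¹ ∙ v z              ≡⟨ ≡.cong (λ y → t ⁻¹ ∙ v y) (Fin.punchIn-punchOut b≢z) ⟨
        t ⁻¹ ∙ v (punchIn b j)  ≡⟨ lookup-++ʳ s-shifted t-shifted j ⟨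
        forbidden (suc n ↑ʳ j)  ∎)
        where
        b≢z : b ≢ z
        b≢z = z≢b ∘ ≡.sym

        j : Fin n
        j = punchOut b≢z

  sum-incrementAt : ∀ {n} (t t′ : Vector Carrier n) (k : Fin n) (x : Carrier) →
    (∀ i → i ≢ k → t′ i ≈ t i) → t′ k ≈ t k ∙ x → ∑ t′ ≈ ∑ t ∙ x
  sum-incrementAt {suc n} t t′ k x elsewhere at-k = begin
    ∑ t′                             ≈⟨ sum-remove {i = k} t′ ⟩
    t′ k ∙ ∑ (removeAt t′ k)         ≈⟨ ∙-cong at-k (sum-cong-≋ λ i → elsewhere _ (Fin.punchInᵢ≢i k i)) ⟩
    (t k ∙ x) ∙ ∑ (removeAt t k)     ≈⟨ xy∙z≈xz∙y _ _ _ ⟩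
    (t k ∙ ∑ (removeAt t k)) ∙ x     ≈⟨ ∙-congʳ (sum-remove {i = k} t) ⟨
    ∑ t ∙ x                          ∎

  module _ {n : ℕ} where

    incident : SimpleGraph n → (Fin n → Fin n → Carrier) → Fin n → Vector Carrier n
    incident G f v u = if adj G v u then f v u else ε

    weight≡∑incident : ∀ G f v → weight A G f v ≡ ∑ (incident G f v)
    weight≡∑incident G f v = foldr-tabulate id
      where
      foldr-tabulate : ∀ {k} (h : Fin k → Fin n) →
        List.foldr (λ u acc → incident G f v u ∙ acc) ε (tabulate h) ≡ ∑ (incident G f v ∘ h)
      foldr-tabulate {zero}  h = refl
      foldr-tabulate {suc k} h = ≡.cong (incident G f v (h zero) ∙_) (foldr-tabulate (h ∘ suc))

    weight-isolated : ∀ G f {v} → ¬ HasNeighbour G v → weight A G f v ≈ ε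
    weight-isolated G f {v} isolated = begin
      weight A G f v         ≡⟨ weight≡∑incident G f v ⟩
      ∑ (incident G f v)     ≈⟨ sum-cong-≋ {n} {incident G f v} no-term ⟩
      ∑ {n} (λ _ → ε)        ≈⟨ sum-replicate-zero n ⟩
      ε                      ∎
      where
      no-term : ∀ u → incident G f v u ≈ ε
      no-term u = reflexive (≡.cong (if_then f v u else ε) (Bool.¬-not (λ vu → isolated (u , vu))))

    record IsIrregularLabeling (G : SimpleGraph n) (f : Fin n → Fin n → Carrier) : Set ℓ where
      field
        symmetric        : IsEdgeLabeling A G f
        label≉ε          : ∀ u v → adj G u v ≡ true → ¬ f u v ≈ ε
        weight≉ε         : ∀ v → HasNeighbour G v → ¬ weight A G f v ≈ ε
        weight-injective : ∀ u v → u ≢ v → HasNeighbour G u → HasNeighbour G v →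
                           ¬ IsK₂Component G u v → ¬ weight A G f u ≈ weight A G f v

    edgeless-irregular : ∀ {G} → ¬ ∃ (HasNeighbour G) → IsIrregularLabeling G (λ _ _ → ε)
    edgeless-irregular edgeless = record
      { symmetric        = λ u _ uv → contradiction (u , _ , uv) edgeless
      ; label≉ε          = λ u _ uv → contradiction (u , _ , uv) edgeless
      ; weight≉ε         = λ v nv → contradiction (v , nv) edgeless
      ; weight-injective = λ u _ _ nu → contradiction (u , nu) edgeless
      }

    module EdgeInsertion (G : SimpleGraph n) {a b : Fin n} (ab : adj G a b ≡ true)
                         (f : Fin n → Fin n → Carrier) (x : Carrier) where

      G′ : SimpleGraph n
      G′ = removeEdge G a b

      f′ : Fin n → Fin n → Carrier
      f′ = overridePair a b x f

      a≢b : a ≢ b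
      a≢b = adj⇒≢ G ab

      incident-other : ∀ {s i} → ¬ SamePair a b s i → incident G f′ s i ≡ incident G′ f s i
      incident-other ¬p =
        ≡.cong₂ (λ e y → if e then y else ε) (≡.sym (overridePair-other ¬p)) (overridePair-other ¬p)

      weight-away : ∀ {z} → z ≢ a → z ≢ b → weight A G f′ z ≡ weight A G′ f z
      weight-away {z} z≢a z≢b = ≡.trans (weight≡∑incident G f′ z) (≡.trans
        (sum-cong-≗ (λ i → incident-other (away⇒¬samePair i z≢a z≢b)))
        (≡.sym (weight≡∑incident G′ f z)))

      weight-endpoint : ∀ {s t} → SamePair a b s t → weight A G f′ s ≈ weight A G′ f s ∙ x
      weight-endpoint {s} {t} p = begin
        weight A G f′ s           ≡⟨ weight≡∑incident G f′ s ⟩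
        ∑ (incident G f′ s)       ≈⟨ sum-incrementAt _ _ t x elsewhere at-t ⟩
        ∑ (incident G′ f s) ∙ x   ≡⟨ ≡.cong (_∙ x) (weight≡∑incident G′ f s) ⟨
        weight A G′ f s ∙ x       ∎
        where
        elsewhere : ∀ i → i ≢ t → incident G f′ s i ≈ incident G′ f s i
        elsewhere i i≢t = reflexive (incident-other (λ q → i≢t (samePair-unique a≢b q p)))

        at-t : incident G f′ s t ≈ incident G′ f s t ∙ x
        at-t rewrite samePair-adj G ab p | overridePair-same {y = x} {g = f} p
                   | overridePair-same {y = false} {g = adj G} p = sym (identityˡ x)

  module Extension {m} (order : HasOrder A m) {n} (2n≤m : 2 * n ≤ m) (G : SimpleGraph n)
                   {a b : Fin n} (ab : adj G a b ≡ true) (f : Fin n → Fin n → Carrier)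
                   (irregular′ : IsIrregularLabeling (removeEdge G a b) f) where

    private
      module IH = IsIrregularLabeling irregular′

    W′ : Fin n → Carrier
    W′ = weight A (removeEdge G a b) f

    -- W′ a ∙ x is to avoid every entry and W′ b ∙ x every entry but the one at b: the entry W′ a
    -- at b encodes x ≉ ε, and the entry ε at a encodes nonzero weights at both endpoints.
    forbidden : Vector Carrier n
    forbidden = updateAt (updateAt W′ a λ _ → ε) b λ _ → W′ a

    forbidden-a : forbidden a ≡ ε
    forbidden-a = ≡.trans (updateAt-minimal a b _ (adj⇒≢ G ab)) (updateAt-updates a W′)

    forbidden-b : forbidden b ≡ W′ a
    forbidden-b = updateAt-updates b _

    forbidden-away : ∀ {z} → z ≢ a → z ≢ b → forbidden z ≡ W′ z
    forbidden-away {z} z≢a z≢b =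
      ≡.trans (updateAt-minimal z b _ z≢b) (updateAt-minimal z a W′ z≢a)

    chosen : ∃ λ x →
      (∀ z → ¬ W′ a ∙ x ≈ forbidden z) × (∀ z → z ≢ b → ¬ W′ b ∙ x ≈ forbidden z)
    chosen = ∃-avoiding-translates order 2n≤m b (W′ a) (W′ b) forbidden

    x : Carrier
    x = proj₁ chosen

    avoid-a : ∀ z → ¬ W′ a ∙ x ≈ forbidden z
    avoid-a = proj₁ (proj₂ chosen)

    avoid-b : ∀ z → z ≢ b → ¬ W′ b ∙ x ≈ forbidden z
    avoid-b = proj₂ (proj₂ chosen)

    open EdgeInsertion G ab f x
    open RemoveEdge G a b

    W : Fin n → Carrier
    W = weight A G f′

    x≉ε : ¬ x ≈ ε
    x≉ε x≈ε = ≡.subst (λ y → ¬ W′ a ∙ x ≈ y) forbidden-b (avoid-a b)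
                (trans (∙-congˡ x≈ε) (identityʳ (W′ a)))

    Wa≈ : W a ≈ W′ a ∙ x
    Wa≈ = weight-endpoint (inj₁ (refl , refl))

    Wb≈ : W b ≈ W′ b ∙ x
    Wb≈ = weight-endpoint (inj₂ (refl , refl))

    Wa≉ε : ¬ W a ≈ ε
    Wa≉ε Wa≈ε = ≡.subst (λ y → ¬ W′ a ∙ x ≈ y) forbidden-a (avoid-a a)
      (trans (sym Wa≈) Wa≈ε)

    Wb≉ε : ¬ W b ≈ ε
    Wb≉ε Wb≈ε = ≡.subst (λ y → ¬ W′ b ∙ x ≈ y) forbidden-a (avoid-b a a≢b)
      (trans (sym Wb≈) Wb≈ε)

    Wa≉W-away : ∀ {z} → z ≢ a → z ≢ b → ¬ W a ≈ W z
    Wa≉W-away z≢a z≢b eq =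
      ≡.subst (λ y → ¬ W′ a ∙ x ≈ y) (forbidden-away z≢a z≢b) (avoid-a _)
      (trans (sym Wa≈) (trans eq (reflexive (weight-away z≢a z≢b))))

    Wb≉W-away : ∀ {z} → z ≢ a → z ≢ b → ¬ W b ≈ W z
    Wb≉W-away z≢a z≢b eq =
      ≡.subst (λ y → ¬ W′ b ∙ x ≈ y) (forbidden-away z≢a z≢b) (avoid-b _ z≢b)
      (trans (sym Wb≈) (trans eq (reflexive (weight-away z≢a z≢b))))

    W′a≉W′b : ¬ IsK₂Component G a b → ¬ W′ a ≈ W′ b
    W′a≉W′b ¬k₂ with hasNeighbour? G′ a | hasNeighbour? G′ b
    ... | yes na | yes nb = IH.weight-injective a b a≢b na nb
        (λ (ab′ , _) → Bool.not-¬ removeEdge-removes ab′)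
    ... | yes na | no ¬nb = λ eq → IH.weight≉ε a na (trans eq (weight-isolated G′ f ¬nb))
    ... | no ¬na | yes nb = λ eq → IH.weight≉ε b nb (trans (sym eq) (weight-isolated G′ f ¬na))
    ... | no ¬na | no ¬nb =
      contradiction
        (ab , only-other (inj₁ (refl , refl)) ¬na , only-other (inj₂ (refl , refl)) ¬nb) ¬k₂
      where
      only-other : ∀ {s t} → SamePair a b s t → ¬ HasNeighbour G′ s →
        ∀ w → adj G s w ≡ true → w ≡ t
      only-other {s} p isolated w sw with samePair? a b s w
      ... | yes q = samePair-unique a≢b q p
      ... | no ¬q = contradiction (w , adj⇒adj-removeEdge ¬q sw) isolated

    Wa≉Wb : ¬ IsK₂Component G a b → ¬ W a ≈ W b
    Wa≉Wb ¬k₂ eq = W′a≉W′b ¬k₂ (∙-cancelʳ x _ _ (trans (sym Wa≈) (trans eq Wb≈)))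

    symmetric : IsEdgeLabeling A G f′
    symmetric u v uv = by-cases (samePair? a b u v)
      where
      by-cases : Dec (SamePair a b u v) → f′ u v ≈ f′ v u
      by-cases (yes p) =
        reflexive (≡.trans (overridePair-same p) (≡.sym (overridePair-same (samePair-swap p))))
      by-cases (no ¬p) = begin
        f′ u v  ≡⟨ overridePair-other ¬p ⟩
        f u v   ≈⟨ IH.symmetric u v (adj⇒adj-removeEdge ¬p uv) ⟩
        f v u   ≡⟨ overridePair-other (¬p ∘ samePair-swap) ⟨
        f′ v u  ∎

    label≉ε : ∀ u v → adj G u v ≡ true → ¬ f′ u v ≈ ε
    label≉ε u v uv = by-cases (samePair? a b u v)
      where
      by-cases : Dec (SamePair a b u v) → ¬ f′ u v ≈ ε
      by-cases (yes p) = ≡.subst (λ y → ¬ y ≈ ε) (≡.sym (overridePair-same p)) x≉ε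
      by-cases (no ¬p) = ≡.subst (λ y → ¬ y ≈ ε) (≡.sym (overridePair-other ¬p))
                           (IH.label≉ε u v (adj⇒adj-removeEdge ¬p uv))

    weight≉ε : ∀ v → HasNeighbour G v → ¬ W v ≈ ε
    weight≉ε v nv with position a b v
    ... | at-a = Wa≉ε
    ... | at-b = Wb≉ε
    ... | away v≢a v≢b = λ Wv≈ε →
      IH.weight≉ε v (HasNeighbour-removeEdge v≢a v≢b nv)
        (trans (reflexive (≡.sym (weight-away v≢a v≢b))) Wv≈ε)

    weight-injective : ∀ u v → u ≢ v → HasNeighbour G u → HasNeighbour G v →
                       ¬ IsK₂Component G u v → ¬ W u ≈ W v
    weight-injective u v u≢v nu nv ¬k₂ with position a b u | position a b v
    ... | at-a           | at-a           = contradiction refl u≢v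
    ... | at-a           | at-b           = Wa≉Wb ¬k₂
    ... | at-a           | away v≢a v≢b   = Wa≉W-away v≢a v≢b
    ... | at-b           | at-a           = Wa≉Wb (¬k₂ ∘ K₂-sym {G = G}) ∘ sym
    ... | at-b           | at-b           = contradiction refl u≢v
    ... | at-b           | away v≢a v≢b   = Wb≉W-away v≢a v≢b
    ... | away u≢a u≢b   | at-a           = Wa≉W-away u≢a u≢b ∘ sym
    ... | away u≢a u≢b   | at-b           = Wb≉W-away u≢a u≢b ∘ sym
    ... | away u≢a u≢b   | away v≢a v≢b   = λ Wu≈Wv →
      IH.weight-injective u v u≢v
        (HasNeighbour-removeEdge u≢a u≢b nu) (HasNeighbour-removeEdge v≢a v≢b nv)
        (¬k₂ ∘ K₂-removeEdge u≢a u≢b v≢a v≢b)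
        (begin
          W′ u  ≡⟨ weight-away u≢a u≢b ⟨
          W u   ≈⟨ Wu≈Wv ⟩
          W v   ≡⟨ weight-away v≢a v≢b ⟩
          W′ v  ∎)

    extension : Σ (Fin n → Fin n → Carrier) (IsIrregularLabeling G)
    extension = f′ , record
      { symmetric        = symmetric
      ; label≉ε          = label≉ε
      ; weight≉ε         = weight≉ε
      ; weight-injective = weight-injective
      }

  irregularLabeling : ∀ {m} → HasOrder A m → ∀ {n} → 2 * n ≤ m → (G : SimpleGraph n) →
    Σ (Fin n → Fin n → Carrier) (IsIrregularLabeling G)
  irregularLabeling order {n} 2n≤m G = go G (<-wellFounded (edgeCount G))
    where
    go : (G : SimpleGraph n) → Acc _<_ (edgeCount G) →
      Σ (Fin n → Fin n → Carrier) (IsIrregularLabeling G)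
    go G (acc smaller) with someEdge? G
    ... | no edgeless = (λ _ _ → ε) , edgeless-irregular edgeless
    ... | yes (a , b , ab) with go (removeEdge G a b) (smaller (edgeCount-removeEdge G ab))
    ...   | f , irregular′ = Extension.extension order 2n≤m G ab f irregular′

theorem3 : ∀ {c ℓ} (n : ℕ) (G : SimpleGraph n) → NoSmallComponents G →
    (A : AbelianGroup c ℓ) (m : ℕ) → HasOrder A m → 2 * n ≤ m →
    Σ (Fin n → Fin n → AbelianGroup.Carrier A) λ f →
      IsEdgeLabeling A G f
      × (∀ u v → adj G u v ≡ true → ¬ (AbelianGroup._≈_ A (f u v) (AbelianGroup.ε A)))
      × (∀ v → ¬ (AbelianGroup._≈_ A (weight A G f v) (AbelianGroup.ε A)))
      × (∀ u v → u ≢ v → ¬ (AbelianGroup._≈_ A (weight A G f u) (weight A G f v)))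
theorem3 n G nsc A m order 2n≤m =
  f , symmetric , label≉ε , (λ v → weight≉ε v (has-neighbour v)) ,
  λ u v u≢v → weight-injective u v u≢v (has-neighbour u) (has-neighbour v)
                 (noSmallComponents⇒¬K₂ nsc u v)
  where
  labeling : Σ (Fin n → Fin n → AbelianGroup.Carrier A) (IsIrregularLabeling A G)
  labeling = irregularLabeling A order 2n≤m G

  f : Fin n → Fin n → AbelianGroup.Carrier A
  f = proj₁ labeling

  open IsIrregularLabeling (proj₂ labeling)

  has-neighbour : ∀ v → HasNeighbour G v
  has-neighbour = noSmallComponents⇒HasNeighbour nsc
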